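{- Let $k\ge2$ and let $T$ be an ordered binary tree with $n\ge2$ leaves. Then the sequence $(n_T(1),\dots,n_T(k))$ is $(n,k)$-admissible.
   Context: In an ordered binary tree (every internal vertex has an ordered pair of children, left and right), the right depth of a leaf is the number of right steps on the path from the root to that leaf. For $i\in\{1,\dots,k\}$, $n_T(i)$ is the number of leaves of $T$ whose right depth is congruent to $i$ modulo $k$. A sequence $(n_1,\dots,n_k)$ of nonnegative integers is $(n,k)$-admissible if (i) $n_1\ge1$, $n_k\ge1$ and $n_1+\dots+n_k=n\ge2$; (ii) if $n_i=0$ for some $i\in\{2,3,\dots,k-2\}$ then $n_{i+1}=0$; (iii) if $n_{k-1}=0$ then $n_k=1$. -}

module Defs where

open import Data.Nat using (ℕ; zero; suc; _+_; _∸_; _≤_; _%_; NonZero)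
open import Data.List using (List; []; _∷_; _++_; map; length; filter)
open import Data.Nat using (_≟_)
open import Relation.Binary.PropositionalEquality using (_≡_)
open import Data.Product using (_×_)

data Tree : Set where
  leaf : Tree
  node : Tree → Tree → Tree

leaves : Tree → ℕ
leaves leaf = 1
leaves (node l r) = leaves l + leaves r

rightDepths : Tree → List ℕ
rightDepths leaf = 0 ∷ []
rightDepths (node l r) = rightDepths l ++ map suc (rightDepths r)

nT : (k : ℕ) .{{_ : NonZero k}} → Tree → ℕ → ℕ
nT k T i = length (filter (λ d → d % k ≟ i % k) (rightDepths T))

sumTo : ℕ → (ℕ → ℕ) → ℕ
sumTo zero f = 0
sumTo (suc m) f = sumTo m f + f (suc m)

record Admissible (n k : ℕ) (s : ℕ → ℕ) : Set where
  field
    first-pos : 1 ≤ s 1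
    last-pos  : 1 ≤ s k
    total     : sumTo k s ≡ n
    n≥2       : 2 ≤ n
    zero-prop : (i : ℕ) → 2 ≤ i → i ≤ k ∸ 2 → s i ≡ 0 → s (suc i) ≡ 0
    km1-zero  : s (k ∸ 1) ≡ 0 → s k ≡ 1

{-# OPTIONS --safe #-}
-- The right depths of the leaves of T form an initial segment {0, …, h} of ℕ, in
-- which 0 occurs exactly once (the leftmost leaf) and 1 occurs as soon as T is not a
-- leaf. So n_1 and n_k = n_0 are positive; a residue class i < k missing from the
-- depths forces h < i, hence every later class below k is missing too; and if k − 1
-- is missing then h < k − 1, so the class of 0 contains only the leftmost leaf.
module Submission where

open import Defs
open import Data.Nat using (ℕ; _≤_; NonZero; zero; suc; _+_; _∸_; _<_; _%_; _≟_; _<?_; z≤n; s≤s; s≤s⁻¹; >-nonZero⁻¹)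
open import Data.Nat.Properties
open import Data.Nat.DivMod using (m<n⇒m%n≡m; n%n≡0; m%n≤m; m%n<n)
open import Algebra.Properties.CommutativeSemigroup +-commutativeSemigroup using (interchange)
open import Data.List using (List; []; _∷_; _++_; map; length; filter)
open import Data.List.Properties using (length-++; length-map; filter-++; filter-some; filter-none; filter-accept; filter-reject)
open import Data.List.Membership.Propositional using (_∈_; lose)
open import Data.List.Membership.Propositional.Properties using (∈-++⁺ˡ; ∈-++⁺ʳ; ∈-++⁻; ∈-map⁺; ∈-map⁻)
open import Data.List.Relation.Unary.All as All using (All; []; _∷_)
open import Data.List.Relation.Unary.Any using (here)
open import Data.Product using (_×_; _,_)
open import Data.Sum using (inj₁; inj₂)
open import Function using (_∘_)
open import Relation.Nullary using (Dec; yes; no; ¬_; contradiction)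
open import Relation.Unary using (Pred; Decidable)
open import Relation.Binary.PropositionalEquality

𝟙 : ∀ {a} {A : Set a} → Dec A → ℕ
𝟙 (yes _) = 1
𝟙 (no _)  = 0

module _ {a p} {A : Set a} {P : Pred A p} (P? : Decidable P) where

  length-filter-∷ : ∀ x xs → length (filter P? (x ∷ xs)) ≡ 𝟙 (P? x) + length (filter P? xs)
  length-filter-∷ x xs with P? x
  ... | yes _ = refl
  ... | no  _ = refl

  length-filter-∈ : ∀ {x xs} → x ∈ xs → P x → 1 ≤ length (filter P? xs)
  length-filter-∈ x∈xs px = filter-some P? (lose x∈xs px)

  filter-cong-All : ∀ {q} {Q : Pred A q} (Q? : Decidable Q) {xs} →
    All (λ x → (P x → Q x) × (Q x → P x)) xs → filter P? xs ≡ filter Q? xs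
  filter-cong-All Q? [] = refl
  filter-cong-All Q? {x ∷ xs} ((P⇒Q , Q⇒P) ∷ rest) with P? x
  ... | yes px = trans (cong (x ∷_) (filter-cong-All Q? rest)) (sym (filter-accept Q? (P⇒Q px)))
  ... | no ¬px = trans (filter-cong-All Q? rest) (sym (filter-reject Q? (¬px ∘ Q⇒P)))

sumTo-cong : ∀ m {f g : ℕ → ℕ} → (∀ {i} → i ≤ m → f i ≡ g i) → sumTo m f ≡ sumTo m g
sumTo-cong zero    f≗g = refl
sumTo-cong (suc m) f≗g = cong₂ _+_ (sumTo-cong m (f≗g ∘ m≤n⇒m≤1+n)) (f≗g ≤-refl)

sumTo-+ : ∀ m (f g : ℕ → ℕ) → sumTo m (λ i → f i + g i) ≡ sumTo m f + sumTo m g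
sumTo-+ zero    f g = refl
sumTo-+ (suc m) f g = trans (cong (_+ (f (suc m) + g (suc m))) (sumTo-+ m f g))
  (interchange (sumTo m f) (sumTo m g) (f (suc m)) (g (suc m)))

sumTo-zero : ∀ m → sumTo m (λ _ → 0) ≡ 0
sumTo-zero zero    = refl
sumTo-zero (suc m) = trans (+-identityʳ _) (sumTo-zero m)

sumTo-≟-beyond : ∀ {m r} → m < r → sumTo m (λ i → 𝟙 (r ≟ i)) ≡ 0
sumTo-≟-beyond {zero}      _   = refl
sumTo-≟-beyond {suc m} {r} m<r with r ≟ suc m
... | yes refl = contradiction m<r (n≮n r)
... | no  _    = trans (+-identityʳ _) (sumTo-≟-beyond (<-trans (n<1+n m) m<r))

-- The extra term r ≟ 0 stands for the last index k of sumTo-%-≟, since k % k = 0.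
sumTo-≟-within : ∀ {m r} → r ≤ m → sumTo m (λ i → 𝟙 (r ≟ i)) + 𝟙 (r ≟ 0) ≡ 1
sumTo-≟-within {zero}  z≤n = refl
sumTo-≟-within {suc m} {r} r≤1+m with r ≟ suc m
... | yes refl = cong (λ s → s + 1 + 0) (sumTo-≟-beyond (n<1+n m))
... | no  r≢1+m = trans (cong (_+ 𝟙 (r ≟ 0)) (+-identityʳ _))
                        (sumTo-≟-within (s≤s⁻¹ (≤∧≢⇒< r≤1+m r≢1+m)))

sumTo-%-≟ : ∀ {k} .{{_ : NonZero k}} {r} → r < k → sumTo k (λ i → 𝟙 (r ≟ i % k)) ≡ 1
sumTo-%-≟ {suc j} {r} r<k = begin
  sumTo j (λ i → 𝟙 (r ≟ i % suc j)) + 𝟙 (r ≟ suc j % suc j)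
    ≡⟨ cong₂ (λ s t → s + 𝟙 (r ≟ t))
             (sumTo-cong j (cong (λ t → 𝟙 (r ≟ t)) ∘ m<n⇒m%n≡m ∘ s≤s))
             (n%n≡0 (suc j)) ⟩
  sumTo j (λ i → 𝟙 (r ≟ i)) + 𝟙 (r ≟ 0)
    ≡⟨ sumTo-≟-within (s≤s⁻¹ r<k) ⟩
  1 ∎
  where open ≡-Reasoning

%≡%⇒≤ : ∀ {k} .{{_ : NonZero k}} {m n} → n < k → m % k ≡ n % k → n ≤ m
%≡%⇒≤ {k} {m} n<k m≡n = subst (_≤ m) (trans m≡n (m<n⇒m%n≡m n<k)) (m%n≤m m k)

residueCount : (k : ℕ) .{{_ : NonZero k}} → List ℕ → ℕ → ℕ
residueCount k L i = length (filter (λ d → d % k ≟ i % k) L)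

DownwardClosed : List ℕ → Set
DownwardClosed L = ∀ {i j} → j ∈ L → i ≤ j → i ∈ L

module _ (k : ℕ) .{{_ : NonZero k}} where

  sumTo-residueCount : ∀ L → sumTo k (residueCount k L) ≡ length L
  sumTo-residueCount [] = sumTo-zero k
  sumTo-residueCount (x ∷ L) = begin
    sumTo k (residueCount k (x ∷ L))
      ≡⟨ sumTo-cong k (λ {i} _ → length-filter-∷ (λ d → d % k ≟ i % k) x L) ⟩
    sumTo k (λ i → 𝟙 (x % k ≟ i % k) + residueCount k L i)
      ≡⟨ sumTo-+ k _ _ ⟩
    sumTo k (λ i → 𝟙 (x % k ≟ i % k)) + sumTo k (residueCount k L)
      ≡⟨ cong₂ _+_ (sumTo-%-≟ (m%n<n x k)) (sumTo-residueCount L) ⟩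
    suc (length L) ∎
    where open ≡-Reasoning

  residueCount-pos : ∀ {L x i} → x ∈ L → x % k ≡ i % k → 1 ≤ residueCount k L i
  residueCount-pos {i = i} = length-filter-∈ (λ d → d % k ≟ i % k)

  residueCount≡0⇒∉ : ∀ {L i} → residueCount k L i ≡ 0 → ¬ i ∈ L
  residueCount≡0⇒∉ none i∈L = n>0⇒n≢0 (residueCount-pos i∈L refl) none

  module _ {L : List ℕ} (closed : DownwardClosed L) where

    residueCount-suc : ∀ {i} → suc i < k → residueCount k L i ≡ 0 → residueCount k L (suc i) ≡ 0
    residueCount-suc {i} 1+i<k none =
      cong length (filter-none (λ d → d % k ≟ suc i % k) (All.tabulate missing))
      where
      missing : ∀ {d} → d ∈ L → ¬ d % k ≡ suc i % k
      missing d∈L d≡1+i = residueCount≡0⇒∉ none (closed d∈L (<⇒≤ (%≡%⇒≤ 1+i<k d≡1+i)))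

    residueCount-last : residueCount k L (k ∸ 1) ≡ 0 → residueCount k L k ≡ length (filter (_≟ 0) L)
    residueCount-last none =
      cong length (filter-cong-All (λ d → d % k ≟ k % k) (_≟ 0) (All.tabulate residue≡0⇔≡0))
      where
      below : ∀ {d} → d ∈ L → d < k
      below {d} d∈L with d <? k ∸ 1
      ... | yes d<k-1 = <-≤-trans d<k-1 (m∸n≤m k 1)
      ... | no  d≮k-1 = contradiction (closed d∈L (≮⇒≥ d≮k-1)) (residueCount≡0⇒∉ none)
      residue≡0⇔≡0 : ∀ {d} → d ∈ L → (d % k ≡ k % k → d ≡ 0) × (d ≡ 0 → d % k ≡ k % k)
      residue≡0⇔≡0 {d} d∈L =
          (λ e → trans (sym d%k≡d) (trans e (n%n≡0 k)))
        , (λ { refl → trans d%k≡d (sym (n%n≡0 k)) })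
        where
        d%k≡d : d % k ≡ d
        d%k≡d = m<n⇒m%n≡m (below d∈L)

0∈rightDepths : ∀ T → 0 ∈ rightDepths T
0∈rightDepths leaf       = here refl
0∈rightDepths (node l r) = ∈-++⁺ˡ (0∈rightDepths l)

1∈rightDepths : ∀ l r → 1 ∈ rightDepths (node l r)
1∈rightDepths l r = ∈-++⁺ʳ (rightDepths l) (∈-map⁺ suc (0∈rightDepths r))

rightDepths-downwardClosed : ∀ T → DownwardClosed (rightDepths T)
rightDepths-downwardClosed leaf       (here refl) z≤n = here refl
rightDepths-downwardClosed (node l r) j∈ i≤j with ∈-++⁻ (rightDepths l) j∈
... | inj₁ j∈l = ∈-++⁺ˡ (rightDepths-downwardClosed l j∈l i≤j)
... | inj₂ j∈r with ∈-map⁻ suc j∈r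
...   | _ , d∈r , refl with i≤j
...     | z≤n      = 0∈rightDepths (node l r)
...     | s≤s i≤d  = ∈-++⁺ʳ (rightDepths l) (∈-map⁺ suc (rightDepths-downwardClosed r d∈r i≤d))

length-rightDepths : ∀ T → length (rightDepths T) ≡ leaves T
length-rightDepths leaf       = refl
length-rightDepths (node l r) = trans (length-++ (rightDepths l))
  (cong₂ _+_ (length-rightDepths l) (trans (length-map suc (rightDepths r)) (length-rightDepths r)))

filter-≟0-map-suc : ∀ xs → filter (_≟ 0) (map suc xs) ≡ []
filter-≟0-map-suc []       = refl
filter-≟0-map-suc (_ ∷ xs) = filter-≟0-map-suc xs

filter-≟0-rightDepths : ∀ T → filter (_≟ 0) (rightDepths T) ≡ 0 ∷ []
filter-≟0-rightDepths leaf       = refl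
filter-≟0-rightDepths (node l r) = trans (filter-++ (_≟ 0) (rightDepths l) (map suc (rightDepths r)))
  (cong₂ _++_ (filter-≟0-rightDepths l) (filter-≟0-map-suc (rightDepths r)))

lemma7p6 : (k : ℕ) .{{_ : NonZero k}} → 2 ≤ k → (T : Tree) → 2 ≤ leaves T →
    Admissible (leaves T) k (nT k T)
lemma7p6 k k≥2 leaf (s≤s ())
lemma7p6 k k≥2 T@(node l r) n≥2 = record
  { first-pos = residueCount-pos k (1∈rightDepths l r) refl
  ; last-pos  = residueCount-pos k (0∈rightDepths T) 0%k≡k%k
  ; total     = trans (sumTo-residueCount k (rightDepths T)) (length-rightDepths T)
  ; n≥2       = n≥2
  ; zero-prop = λ i _ i≤k-2 → residueCount-suc k closed (1+i<k i≤k-2)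
  ; km1-zero  = λ none → trans (residueCount-last k closed none) (cong length (filter-≟0-rightDepths T))
  }
  where
  closed : DownwardClosed (rightDepths T)
  closed = rightDepths-downwardClosed T
  1+i<k : ∀ {i} → i ≤ k ∸ 2 → suc i < k
  1+i<k i≤k-2 = ≤-trans (s≤s (s≤s i≤k-2)) (≤-reflexive (m+[n∸m]≡n k≥2))
  0%k≡k%k : 0 % k ≡ k % k
  0%k≡k%k = trans (m<n⇒m%n≡m (>-nonZero⁻¹ k)) (sym (n%n≡0 k))
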